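{- Let $\Sigma$ be a signed graph such that $\Sigma{:}E^-$ is bipartite with connected components $C_1,\dots,C_m$, and for each $i$ let $\{V_{i1},V_{i2}\}$ be the unique stable bipartition of $C_i$. Let $\tau$ be the transposition of $\{1,2\}$. Let $w_1<w_2<\dots<w_l$ be the distinct finite values in $\{d^+(V_{i\alpha},V_{j\beta}) : i,j\in[m],\ \alpha,\beta\in[2],\ (i,\alpha)\ne(j,\beta)\}$. For $k\in[l]$ let $E_k'=\{(V_{i\alpha},V_{j\beta}) : (i,\alpha)\neq (j,\beta),\ d^+(V_{i\alpha},V_{j\beta})\le w_k\}$, $E_k''=\{(V_{i\tau(\alpha)},V_{j\tau(\beta)}) : (i,\alpha)\neq (j,\beta),\ d^+(V_{i\alpha},V_{j\beta})\le w_k\}$, $E_k=E_k'\cup E_k''$, and let $\Phi_k$ be the signed graph with vertex set $\{V_{i\alpha}: i\in[m],\alpha\in[2]\}$ (each $V_{i\alpha}$ treated as a single vertex), negative edge set $\{(V_{i1},V_{i2}) : i\in[m]\}$ and positive edge set $E_k$. Let $\mathcal{D}$ be the collection of all stable bipartitions $\{X,Y\}$ of $\Sigma{:}E^-$. If $p$ is the smallest integer in $[l]$ such that $\Phi_p$ is unbalanced, then $$\max_{\{X,Y\}\in\mathcal{D}} d^+(X,Y)=w_p.$$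
   Context: A signed graph is a pair $(\Gamma,\sigma)$ with $\sigma: E(\Gamma)\to\{+,-\}$ (the auxiliary graphs $\Phi_k$ may have a positive and a negative edge between the same two vertices, forming a negative digon, which counts as a negative circle). The sign of a circle is the product of its edge signs; a signed graph is balanced if every circle is positive. $\Sigma{:}E^-$ is the subgraph of $\Sigma$ consisting of the negative edges and their endpoints. A stable bipartition of a graph is a bipartition of its vertex set into two classes each containing no edge of that graph. The positive subgraph $\Sigma^+$ has vertex set $V(\Sigma)$ and the positive edges of $\Sigma$; $d^+(x,y)$ is the distance from $x$ to $y$ in $\Sigma^+$ ($\infty$ if there is no path), and for vertex sets $X,Y$, $d^+(X,Y)=\min_{(x,y)\in X\times Y}d^+(x,y)$. $[n]=\{1,\dots,n\}$. -}

module Defs where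

open import Data.Nat using (ℕ; zero; suc; _≤_; _<_)
open import Data.Fin using (Fin; zero; suc)
open import Data.Product using (Σ; ∃; _×_; _,_; proj₁; proj₂)
open import Data.Sum using (_⊎_; inj₁; inj₂)
open import Data.Sign using (Sign; +; -; _*_)
open import Relation.Binary.PropositionalEquality using (_≡_; _≢_)
open import Relation.Binary.Construct.Closure.ReflexiveTransitive using (Star)
open import Relation.Nullary using (¬_)
open import Function using (_∘_)
open import Data.Unit using (⊤)
open import Data.Empty using (⊥)
open import Function.Definitions using (Injective)

record SignedGraph (V E : Set) : Set where
  field
    ends : E → V × V
    sign : E → Sign
open SignedGraph public

Joins : ∀ {V E} → SignedGraph V E → E → V → V → Set
Joins G e u v = ends G e ≡ (u , v) ⊎ ends G e ≡ (v , u)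

-- cyclic successor on Fin (suc k)
next : ∀ {k} → Fin (suc k) → Fin (suc k)
next {zero} _ = zero
next {suc k} zero = suc zero
next {suc k} (suc t) with next {k} t
... | zero = zero
... | suc s = suc (suc s)

signProd : ∀ {k} → (Fin k → Sign) → Sign
signProd {zero} _ = +
signProd {suc k} f = f zero * signProd (f ∘ suc)

-- A circle of length (suc k): distinct vertices v_0..v_k and distinct
-- edges e_0..e_k with e_t joining v_t and v_{t+1 mod (k+1)}.
-- (length 1 = loop, length 2 = digon of two parallel edges)
record Circle {V E : Set} (G : SignedGraph V E) : Set where
  field
    len-1 : ℕ
    vtx   : Fin (suc len-1) → V
    edg   : Fin (suc len-1) → E
    vtx-inj : Injective _≡_ _≡_ vtx
    edg-inj : Injective _≡_ _≡_ edg
    joins : ∀ t → Joins G (edg t) (vtx t) (vtx (next t))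

circleSign : ∀ {V E} {G : SignedGraph V E} → Circle G → Sign
circleSign {G = G} C = signProd (sign G ∘ Circle.edg C)

Balanced : ∀ {V E} → SignedGraph V E → Set
Balanced G = (C : Circle G) → circleSign C ≡ +

data ℕ∞ : Set where
  fin : ℕ → ℕ∞
  ∞   : ℕ∞

_≤∞_ : ℕ∞ → ℕ∞ → Set
fin a ≤∞ fin b = a ≤ b
_     ≤∞ ∞     = ⊤
∞     ≤∞ fin b = ⊥

module _ {n e : ℕ} (S : SignedGraph (Fin n) (Fin e)) where

  -- v is a vertex of Σ:E⁻ (an endpoint of a negative edge)
  InNeg : Fin n → Set
  InNeg v = ∃ λ f → sign S f ≡ - × (v ≡ proj₁ (ends S f) ⊎ v ≡ proj₂ (ends S f))

  NegAdj : Fin n → Fin n → Set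
  NegAdj u v = ∃ λ f → sign S f ≡ - × Joins S f u v

  NegConn : Fin n → Fin n → Set
  NegConn = Star NegAdj

  PosAdj : Fin n → Fin n → Set
  PosAdj u v = ∃ λ f → sign S f ≡ + × Joins S f u v

  data PosWalk : Fin n → Fin n → ℕ → Set where
    here : ∀ {x} → PosWalk x x 0
    step : ∀ {x y z k} → PosAdj x y → PosWalk y z k → PosWalk x z (suc k)

  WalkBetween : (Fin n → Set) → (Fin n → Set) → ℕ → Set
  WalkBetween X Y k = ∃ λ x → ∃ λ y → X x × Y y × PosWalk x y k

  -- d⁺(X,Y) = d  (distance as a relation, with ∞)
  IsDist⁺ : (Fin n → Set) → (Fin n → Set) → ℕ∞ → Set
  IsDist⁺ X Y (fin k) = WalkBetween X Y k × (∀ j → j < k → ¬ WalkBetween X Y j)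
  IsDist⁺ X Y ∞ = ∀ j → ¬ WalkBetween X Y j


  -- a stable bipartition of Σ:E⁻, given by a 2-colouring f of its vertices:
  -- classes X = {v ∈ V(Σ:E⁻) : f v = 0}, Y = {v ∈ V(Σ:E⁻) : f v = 1}
  StableCol : (Fin n → Fin 2) → Set
  StableCol f = ∀ g → sign S g ≡ - → f (proj₁ (ends S g)) ≢ f (proj₂ (ends S g))

  ClassOf : (Fin n → Fin 2) → Fin 2 → Fin n → Set
  ClassOf f α v = InNeg v × f v ≡ α

  -- Connected components C_1..C_m of Σ:E⁻ (comp v = i  means v ∈ C_i)
  -- together with the stable bipartition {V_i1, V_i2} of each C_i
  -- (side v = α means v ∈ V_{iα}).  Existence of such data is exactly
  -- bipartiteness of Σ:E⁻.
  record Components (m : ℕ) : Set where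
    field
      comp : Fin n → Fin m
      side : Fin n → Fin 2
      comp-conn : ∀ u v → InNeg u → InNeg v → (comp u ≡ comp v → NegConn u v) × (NegConn u v → comp u ≡ comp v)
      comp-onto : ∀ i → ∃ λ v → InNeg v × comp v ≡ i
      side-stable : StableCol side

    Part : Fin m × Fin 2 → Fin n → Set
    Part (i , α) v = InNeg v × comp v ≡ i × side v ≡ α

  τ : Fin 2 → Fin 2
  τ zero = suc zero
  τ (suc _) = zero

  module _ {m : ℕ} (C : Components m) where
    open Components C

    InW : ℕ → Set
    InW d = ∃ λ a → ∃ λ b → a ≢ b × IsDist⁺ (Part a) (Part b) (fin d)

    E′ : ℕ → Fin m × Fin 2 → Fin m × Fin 2 → Set
    E′ w a b = a ≢ b × ∃ λ d → IsDist⁺ (Part a) (Part b) (fin d) × d ≤ w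

    E″ : ℕ → Fin m × Fin 2 → Fin m × Fin 2 → Set
    E″ w a b = ∃ λ a′ → ∃ λ b′ →
      a ≡ (proj₁ a′ , τ (proj₂ a′)) × b ≡ (proj₁ b′ , τ (proj₂ b′)) × E′ w a′ b′

    -- edges of Φ: negative edges indexed by i ∈ [m], positive edges
    -- the pairs in E′ ∪ E″
    ΦEdge : ℕ → Set
    ΦEdge w = Fin m ⊎ (Σ (Fin m × Fin 2) λ a → Σ (Fin m × Fin 2) λ b → E′ w a b ⊎ E″ w a b)

    Φ : (w : ℕ) → SignedGraph (Fin m × Fin 2) (ΦEdge w)
    ends (Φ w) (inj₁ i) = ((i , zero) , (i , suc zero))
    ends (Φ w) (inj₂ (a , b , _)) = (a , b)
    sign (Φ w) (inj₁ _) = -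
    sign (Φ w) (inj₂ _) = +

-- Colour the vertices V_{iα} of Φ by signs.  A stable bipartition {X,Y} of Σ:E⁻ gives each component
-- C_i one of its two orientations, hence a colouring in which V_{i1} and V_{i2} get opposite signs.  If
-- d⁺(X,Y) > w, parts at distance ≤ w lie in the same class and get equal signs, and so do their flips,
-- so the colouring switches Φ_w to all-positive and Φ_w is balanced: unbalanced Φ_{w_p} forces
-- d⁺(X,Y) ≤ w_p.  Conversely Φ_{w_{p-1}} is balanced, so by Harary's theorem it has such a switching;
-- read as a bipartition, a shorter walk between its classes would join two parts at distance < w_p,
-- hence ≤ w_{p-1}, which the switching colours alike; and if no walk had length w_p, the first argument
-- would balance Φ_{w_p}.  So this bipartition attains w_p.

module Submission where

open import Defs
open import Data.Nat using (ℕ; zero; suc; _<_; _≤_; z≤n; s≤s; _≤?_) renaming (_≟_ to _≟ℕ_)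
open import Data.Nat.Properties
  using (≤-refl; ≤-trans; ≤-pred; <⇒≤; <⇒≱; ≰⇒>; ≤∧≢⇒<; ≤-<-trans; <-≤-trans; m≤n⇒m≤1+n; m≢1+n+m; anyUpTo?; allUpTo?)
open import Data.Nat.Induction using (<-rec)
open import Data.Fin using (Fin; zero; suc; toℕ; inject₁) renaming (_<_ to _<ᶠ_; _≤_ to _≤ᶠ_; _≟_ to _≟ᶠ_)
open import Data.Fin.Properties using (any?; toℕ-inject₁; ≤̄⇒inject₁<) renaming (≤-refl to ≤ᶠ-refl; _≤?_ to _≤ᶠ?_; ≤∧≢⇒< to ≤∧≢⇒<ᶠ)
open import Data.Product using (Σ; ∃; _×_; _,_; proj₁; proj₂)
open import Data.Product.Properties using (≡-dec)
open import Data.Sum using (_⊎_; inj₁; inj₂)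
open import Data.Sign using (Sign; +; -; _*_) renaming (_≟_ to _≟ˢ_)
open import Data.Sign.Properties using (*-comm; *-assoc; s*s≡+; *-identityʳ; s*opposite[s]≡-; *-commutativeSemigroup)
open import Algebra.Properties.CommutativeSemigroup *-commutativeSemigroup using (interchange; x∙yz≈y∙xz)
open import Data.Empty using (⊥-elim)
open import Data.List using (List; []; _∷_; cartesianProduct; allFin)
open import Data.List.Relation.Unary.All as All using (All; []; _∷_)
open import Data.List.Relation.Unary.Any using (here; there)
open import Data.List.Membership.Propositional using (_∈_)
open import Data.List.Membership.Propositional.Properties using (∈-cartesianProduct⁺; ∈-allFin)
open import Function using (_∘_; case_of_)
open import Function.Definitions using (Injective)
open import Relation.Binary.Definitions using (DecidableEquality)
open import Relation.Binary.PropositionalEquality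
  using (_≡_; _≢_; refl; sym; trans; cong; cong₂; subst; subst₂; module ≡-Reasoning)
open import Relation.Binary.Construct.Closure.ReflexiveTransitive using (ε; _◅_)
open import Relation.Nullary using (¬_; Dec; yes; no)
open import Relation.Nullary.Decidable using (_×-dec_; _⊎-dec_; ¬?; map′)
open import Relation.Unary using (Decidable)

*-cancelˡ-self : ∀ s t → s * (s * t) ≡ t
*-cancelˡ-self s t = trans (sym (*-assoc s s t)) (cong (_* t) (s*s≡+ s))

*-cancelʳ-self : ∀ s t → (s * t) * t ≡ s
*-cancelʳ-self s t = trans (*-assoc s t t) (trans (cong (s *_) (s*s≡+ t)) (*-identityʳ s))

*-switch : ∀ s a b → (s * a) * (s * b) ≡ a * b
*-switch s a b = trans (interchange s a s b) (cong (_* (a * b)) (s*s≡+ s))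

*≡+⇒≡ : ∀ {s t} → s * t ≡ + → s ≡ t
*≡+⇒≡ {s} {t} st≡+ = begin
  s           ≡⟨ sym (*-identityʳ s) ⟩
  s * +       ≡⟨ cong (s *_) (sym st≡+) ⟩
  s * (s * t) ≡⟨ *-cancelˡ-self s t ⟩
  t           ∎
  where open ≡-Reasoning

signProd-cong : ∀ {k} {f g : Fin k → Sign} → (∀ t → f t ≡ g t) → signProd f ≡ signProd g
signProd-cong {zero} _ = refl
signProd-cong {suc k} f≗g = cong₂ _*_ (f≗g zero) (signProd-cong (f≗g ∘ suc))

signProd-* : ∀ {k} (f g : Fin k → Sign) → signProd (λ t → f t * g t) ≡ signProd f * signProd g
signProd-* {zero} f g = refl
signProd-* {suc k} f g = trans (cong (f zero * g zero *_) (signProd-* (f ∘ suc) (g ∘ suc)))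
                               (interchange (f zero) (g zero) (signProd (f ∘ suc)) (signProd (g ∘ suc)))

-- Deleting index 1 from a cycle on Fin (2+k) leaves the cycle on Fin (1+k).
dropSecond : ∀ {A : Set} {k} → (Fin (suc (suc k)) → A) → Fin (suc k) → A
dropSecond g zero = g zero
dropSecond g (suc s) = g (suc (suc s))

next-suc : ∀ {A : Set} {k} (g : Fin (suc (suc k)) → A) (t : Fin (suc k)) →
  g (next (suc t)) ≡ dropSecond g (next t)
next-suc g t with next t
... | zero = refl
... | suc s = refl

next-view : ∀ {k} (t : Fin (suc k)) → (toℕ t ≡ k × next t ≡ zero) ⊎ toℕ (next t) ≡ suc (toℕ t)
next-view {zero} zero = inj₁ (refl , refl)
next-view {suc k} zero = inj₂ refl
next-view {suc k} (suc t) with next t | next-view t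
... | zero  | inj₁ (t≡k , _) = inj₁ (cong suc t≡k , refl)
... | suc s | inj₂ ≡suc      = inj₂ (cong suc ≡suc)

next∘next-noFixpoint : ∀ {k} (s : Fin (suc (suc (suc k)))) → next (next s) ≢ s
next∘next-noFixpoint s eq with next-view s | next-view (next s)
... | inj₁ (s≡last , next≡0) | _ =
  case trans (sym (cong (toℕ ∘ next) next≡0)) (trans (cong toℕ eq) s≡last) of λ ()
... | inj₂ next≡suc | inj₁ (next≡last , next²≡0) =
  case trans (cong suc (trans (sym (cong toℕ next²≡0)) (cong toℕ eq))) (trans (sym next≡suc) next≡last) of λ ()
... | inj₂ next≡suc | inj₂ next²≡suc =
  m≢1+n+m (toℕ s) (trans (sym (cong toℕ eq)) (trans next²≡suc (cong suc next≡suc)))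

signProd-rotate : ∀ {k} (g : Fin (suc k) → Sign) → signProd (g ∘ next) ≡ signProd g
signProd-rotate {zero} g = refl
signProd-rotate {suc k} g = begin
  g (suc zero) * signProd (λ s → g (next (suc s)))           ≡⟨ cong (g (suc zero) *_) (signProd-cong (next-suc g)) ⟩
  g (suc zero) * signProd (dropSecond g ∘ next)              ≡⟨ cong (g (suc zero) *_) (signProd-rotate (dropSecond g)) ⟩
  g (suc zero) * (g zero * signProd (λ s → g (suc (suc s)))) ≡⟨ x∙yz≈y∙xz (g (suc zero)) (g zero) _ ⟩
  g zero * (g (suc zero) * signProd (λ s → g (suc (suc s)))) ∎
  where open ≡-Reasoning

PositiveSwitching : ∀ {V E} → SignedGraph V E → (V → Sign) → Set
PositiveSwitching G h = ∀ e → sign G e ≡ h (proj₁ (ends G e)) * h (proj₂ (ends G e))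

positiveSwitching-joins : ∀ {V E} {G : SignedGraph V E} {h e u v} →
  PositiveSwitching G h → Joins G e u v → sign G e ≡ h u * h v
positiveSwitching-joins {G = G} {h} {e} switching (inj₁ ends≡) =
  subst (λ (x , y) → sign G e ≡ h x * h y) ends≡ (switching e)
positiveSwitching-joins {G = G} {h} {e} {u} {v} switching (inj₂ ends≡) =
  trans (subst (λ (x , y) → sign G e ≡ h x * h y) ends≡ (switching e)) (*-comm (h v) (h u))

-- Each vertex of a circle contributes its switching sign twice.
positiveSwitching⇒balanced : ∀ {V E} {G : SignedGraph V E} {h} → PositiveSwitching G h → Balanced G
positiveSwitching⇒balanced {G = G} {h} switching C = begin
  signProd (sign G ∘ edg)
    ≡⟨ signProd-cong (λ t → positiveSwitching-joins {h = h} switching (joins t)) ⟩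
  signProd (λ t → h (vtx t) * h (vtx (next t)))
    ≡⟨ signProd-* (h ∘ vtx) (h ∘ vtx ∘ next) ⟩
  signProd (h ∘ vtx) * signProd (h ∘ vtx ∘ next)
    ≡⟨ cong (signProd (h ∘ vtx) *_) (signProd-rotate (h ∘ vtx)) ⟩
  signProd (h ∘ vtx) * signProd (h ∘ vtx)
    ≡⟨ s*s≡+ (signProd (h ∘ vtx)) ⟩
  + ∎
  where open ≡-Reasoning
        open Circle C

joins-sym : ∀ {V E} {G : SignedGraph V E} {e u v} → Joins G e u v → Joins G e v u
joins-sym (inj₁ p) = inj₂ p
joins-sym (inj₂ p) = inj₁ p

joins-unique : ∀ {V E} {G : SignedGraph V E} {e u v u′ v′} →
  Joins G e u v → Joins G e u′ v′ → u ≡ u′ ⊎ (u ≡ v′ × v ≡ u′)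
joins-unique (inj₁ p) (inj₁ p′) = inj₁ (cong proj₁ (trans (sym p) p′))
joins-unique (inj₁ p) (inj₂ p′) = inj₂ (cong proj₁ (trans (sym p) p′) , cong proj₂ (trans (sym p) p′))
joins-unique (inj₂ p) (inj₁ p′) = inj₂ (cong proj₂ (trans (sym p) p′) , cong proj₁ (trans (sym p) p′))
joins-unique (inj₂ p) (inj₂ p′) = inj₁ (cong proj₂ (trans (sym p) p′))

EdgeWith : ∀ {V E} → SignedGraph V E → V → V → Sign → Set
EdgeWith G u v σ = ∃ λ e → ends G e ≡ (u , v) × sign G e ≡ σ

module Walks {V E : Set} (G : SignedGraph V E) where

  Step : V → V → Set
  Step u v = Σ E λ e → Joins G e u v

  infixr 5 _∷_ _++_

  data Walk : V → V → Set where
    []  : ∀ {v} → Walk v v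
    _∷_ : ∀ {u x v} → Step u x → Walk x v → Walk u v

  length : ∀ {u v} → Walk u v → ℕ
  length [] = 0
  length (_ ∷ q) = suc (length q)

  walkSign : ∀ {u v} → Walk u v → Sign
  walkSign [] = +
  walkSign ((e , _) ∷ q) = sign G e * walkSign q

  _++_ : ∀ {u v w} → Walk u v → Walk v w → Walk u w
  [] ++ r = r
  (s ∷ q) ++ r = s ∷ (q ++ r)

  walkSign-++ : ∀ {u v w} (q : Walk u v) (r : Walk v w) → walkSign (q ++ r) ≡ walkSign q * walkSign r
  walkSign-++ [] r = refl
  walkSign-++ ((e , _) ∷ q) r =
    trans (cong (sign G e *_) (walkSign-++ q r)) (sym (*-assoc (sign G e) (walkSign q) (walkSign r)))

  reverse : ∀ {u v} → Walk u v → Walk v u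
  reverse [] = []
  reverse ((e , j) ∷ q) = reverse q ++ ((e , joins-sym {G = G} j) ∷ [])

  walkSign-reverse : ∀ {u v} (q : Walk u v) → walkSign (reverse q) ≡ walkSign q
  walkSign-reverse [] = refl
  walkSign-reverse ((e , j) ∷ q) = begin
    walkSign (reverse q ++ ((e , joins-sym {G = G} j) ∷ [])) ≡⟨ walkSign-++ (reverse q) _ ⟩
    walkSign (reverse q) * (sign G e * +)                    ≡⟨ cong₂ _*_ (walkSign-reverse q) (*-identityʳ (sign G e)) ⟩
    walkSign q * sign G e                                    ≡⟨ *-comm (walkSign q) (sign G e) ⟩
    sign G e * walkSign q                                    ∎
    where open ≡-Reasoning

  -- the i-th vertex, read as the end vertex once i ≥ length q
  vertexAt : ∀ {u v} → Walk u v → ℕ → V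
  vertexAt {u} [] _ = u
  vertexAt {u} (_ ∷ _) zero = u
  vertexAt (_ ∷ q) (suc i) = vertexAt q i

  vertexAt-length : ∀ {u v} (q : Walk u v) → vertexAt q (length q) ≡ v
  vertexAt-length [] = refl
  vertexAt-length (_ ∷ q) = vertexAt-length q

  edgeAt : ∀ {u v} (q : Walk u v) → Fin (length q) → E
  edgeAt ((e , _) ∷ _) zero = e
  edgeAt (_ ∷ q) (suc t) = edgeAt q t

  edgeAt-joins : ∀ {u v} (q : Walk u v) (t : Fin (length q)) →
    Joins G (edgeAt q t) (vertexAt q (toℕ t)) (vertexAt q (suc (toℕ t)))
  edgeAt-joins ((_ , j) ∷ []) zero = j
  edgeAt-joins ((_ , j) ∷ (_ ∷ _)) zero = j
  edgeAt-joins (_ ∷ q) (suc t) = edgeAt-joins q t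

  signProd-edgeAt : ∀ {u v} (q : Walk u v) → signProd (sign G ∘ edgeAt q) ≡ walkSign q
  signProd-edgeAt [] = refl
  signProd-edgeAt ((e , _) ∷ q) = cong (sign G e *_) (signProd-edgeAt q)

  -- only the start vertices of the steps must be distinct, so a closed walk can be simple
  Simple : ∀ {u v} → Walk u v → Set
  Simple q = ∀ (s t : Fin (length q)) → vertexAt q (toℕ s) ≡ vertexAt q (toℕ t) → s ≡ t

  closedWalk-joins : ∀ {a x} (s : Step a x) (q : Walk x a) (t : Fin (length (s ∷ q))) →
    Joins G (edgeAt (s ∷ q) t) (vertexAt (s ∷ q) (toℕ t)) (vertexAt (s ∷ q) (toℕ (next t)))
  closedWalk-joins s q t = subst (Joins G _ _) vertexAt-next (edgeAt-joins (s ∷ q) t)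
    where
    vertexAt-next : vertexAt (s ∷ q) (suc (toℕ t)) ≡ vertexAt (s ∷ q) (toℕ (next t))
    vertexAt-next with next-view t
    ... | inj₁ (t≡last , next≡0) = trans (cong (vertexAt q) t≡last)
                                     (trans (vertexAt-length q) (cong (vertexAt (s ∷ q) ∘ toℕ) (sym next≡0)))
    ... | inj₂ next≡suc = cong (vertexAt (s ∷ q)) (sym next≡suc)

  digon-positive : ∀ σ → σ * (σ * +) ≢ -
  digon-positive + ()
  digon-positive - ()

  -- In a simple closed walk an edge can recur only as a back-and-forth digon, which is positive.
  edgeAt-injective : ∀ {a x} (s : Step a x) (q : Walk x a) →
    Simple (s ∷ q) → walkSign (s ∷ q) ≡ - → Injective _≡_ _≡_ (edgeAt (s ∷ q))
  edgeAt-injective _ [] _ _ {zero} {zero} _ = refl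
  edgeAt-injective _ (_ ∷ []) _ _ {zero} {zero} _ = refl
  edgeAt-injective _ (_ ∷ []) _ _ {suc zero} {suc zero} _ = refl
  edgeAt-injective (e , _) (_ ∷ []) _ negative {zero} {suc zero} refl = ⊥-elim (digon-positive (sign G e) negative)
  edgeAt-injective (e , _) (_ ∷ []) _ negative {suc zero} {zero} refl = ⊥-elim (digon-positive (sign G e) negative)
  edgeAt-injective s q@(_ ∷ _ ∷ _) simple _ {i} {j} edge≡
    with joins-unique {G = G} (closedWalk-joins s q i) (subst (λ e → Joins G e _ _) (sym edge≡) (closedWalk-joins s q j))
  ... | inj₁ vertex≡ = simple i j vertex≡
  ... | inj₂ (i-meets-next-j , next-i-meets-j) =
        ⊥-elim (next∘next-noFixpoint i (trans (cong next (simple (next i) j next-i-meets-j))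
                                              (sym (simple i (next j) i-meets-next-j))))

  simpleNegativeLoop⇒circle : ∀ {a x} (s : Step a x) (q : Walk x a) →
    Simple (s ∷ q) → walkSign (s ∷ q) ≡ - → Σ (Circle G) λ C → circleSign C ≡ -
  simpleNegativeLoop⇒circle s q simple negative = C , trans (signProd-edgeAt (s ∷ q)) negative
    where
    C : Circle G
    C = record { len-1 = length q ; vtx = vertexAt (s ∷ q) ∘ toℕ ; edg = edgeAt (s ∷ q)
               ; vtx-inj = λ {i} {j} → simple i j ; edg-inj = edgeAt-injective s q simple negative
               ; joins = closedWalk-joins s q }

module ClosedWalks {V E : Set} (G : SignedGraph V E) (_≟_ : DecidableEquality V) where
  open Walks G

  record Visit {x b} (a : V) (q : Walk x b) : Set where
    field
      before          : Walk x a
      after           : Walk a b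
      before-shorter  : length before < length q
      after-noLonger  : length after ≤ length q
      sign-split      : walkSign q ≡ walkSign before * walkSign after

  visit? : ∀ a {x b} (q : Walk x b) → Visit a q ⊎ (∀ (t : Fin (length q)) → vertexAt q (toℕ t) ≢ a)
  visit? a [] = inj₂ λ ()
  visit? a {x} (s ∷ q) with x ≟ a
  ... | yes refl = inj₁ (record { before = [] ; after = s ∷ q ; before-shorter = s≤s z≤n
                                ; after-noLonger = ≤-refl ; sign-split = refl })
  ... | no x≢a with visit? a q
  ...   | inj₂ avoids = inj₂ λ { zero → x≢a ; (suc t) → avoids t }
  ...   | inj₁ v = inj₁ (record
          { before = s ∷ before ; after = after ; before-shorter = s≤s before-shorter
          ; after-noLonger = m≤n⇒m≤1+n after-noLonger
          ; sign-split = trans (cong (sign G (proj₁ s) *_) sign-split)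
                               (sym (*-assoc (sign G (proj₁ s)) (walkSign before) (walkSign after))) })
    where open Visit v

  record Shortcut {a b} (q : Walk a b) : Set where
    field
      {pivot}       : V
      loop          : Walk pivot pivot
      rest          : Walk a b
      loop-shorter  : length loop < length q
      rest-shorter  : length rest < length q
      sign-split    : walkSign q ≡ walkSign loop * walkSign rest

  simple⊎shortcut : ∀ {a b} (q : Walk a b) → Simple q ⊎ Shortcut q
  simple⊎shortcut [] = inj₁ λ ()
  simple⊎shortcut {a} (s ∷ q) with simple⊎shortcut q
  ... | inj₂ sc = inj₂ (record
        { loop = loop ; rest = s ∷ rest ; loop-shorter = m≤n⇒m≤1+n loop-shorter ; rest-shorter = s≤s rest-shorter
        ; sign-split = trans (cong (sign G (proj₁ s) *_) sign-split)
                             (x∙yz≈y∙xz (sign G (proj₁ s)) (walkSign loop) (walkSign rest)) })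
    where open Shortcut sc
  ... | inj₁ simple with visit? a q
  ...   | inj₁ v = inj₂ (record
          { loop = s ∷ before ; rest = after ; loop-shorter = s≤s before-shorter ; rest-shorter = s≤s after-noLonger
          ; sign-split = trans (cong (sign G (proj₁ s) *_) sign-split)
                               (sym (*-assoc (sign G (proj₁ s)) (walkSign before) (walkSign after))) })
    where open Visit v
  ...   | inj₂ avoids = inj₁ simple′
    where
    simple′ : Simple (s ∷ q)
    simple′ zero zero _ = refl
    simple′ zero (suc t) a≡vt = ⊥-elim (avoids t (sym a≡vt))
    simple′ (suc i) zero vi≡a = ⊥-elim (avoids i vi≡a)
    simple′ (suc i) (suc t) vi≡vt = cong suc (simple i t vi≡vt)

  -- A shortest negative closed walk would be simple, hence a negative circle.
  balanced⇒closedWalk-positive : Balanced G → ∀ {a} (q : Walk a a) → walkSign q ≡ +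
  balanced⇒closedWalk-positive balanced q = shorterThan (suc (length q)) q ≤-refl
    where
    shorterThan : ∀ N {a} (q : Walk a a) → length q < N → walkSign q ≡ +
    shorterThan (suc N) q q<N with simple⊎shortcut q
    ... | inj₂ sc = trans sign-split (cong₂ _*_ (shorterThan N loop (<-≤-trans loop-shorter (≤-pred q<N)))
                                                 (shorterThan N rest (<-≤-trans rest-shorter (≤-pred q<N))))
      where open Shortcut sc
    shorterThan (suc N) [] _ | inj₁ _ = refl
    shorterThan (suc N) (s ∷ q) _ | inj₁ simple with walkSign (s ∷ q) in sign≡
    ... | + = refl
    ... | - with simpleNegativeLoop⇒circle s q simple sign≡
    ...   | C , C-negative = case trans (sym C-negative) (balanced C) of λ ()

module Harary {V E : Set} (G : SignedGraph V E) (_≟_ : DecidableEquality V) where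
  open Walks G
  open ClosedWalks G _≟_

  -- Union–find state: a switching of the edges inserted so far, certified on each tree by walks from its root.
  record Forest : Set where
    field
      root        : V → V
      colour      : V → Sign
      root-idem   : ∀ v → root (root v) ≡ root v
      root-colour : ∀ v → colour (root v) ≡ +
      path        : ∀ v → Walk (root v) v
      path-sign   : ∀ v → walkSign (path v) ≡ colour v

    pathFrom : ∀ {r v} → root v ≡ r → Walk r v
    pathFrom {v = v} refl = path v

    pathFrom-sign : ∀ {r v} (v~r : root v ≡ r) → walkSign (pathFrom v~r) ≡ colour v
    pathFrom-sign {v = v} refl = path-sign v

  Consistent : Forest → V → V → Sign → Set
  Consistent F u v σ = root u ≡ root v × σ ≡ colour u * colour v
    where open Forest F

  _⊑_ : Forest → Forest → Set
  F ⊑ F′ = ∀ {u v σ} → Consistent F u v σ → Consistent F′ u v σ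

  discreteForest : Forest
  discreteForest = record { root = λ v → v ; colour = λ _ → + ; root-idem = λ _ → refl
                          ; root-colour = λ _ → refl ; path = λ _ → [] ; path-sign = λ _ → refl }

  module Link (F : Forest) {u v e} (j : Joins G e u v) (roots≢ : Forest.root F u ≢ Forest.root F v) where
    open Forest F

    -- switching the tree of v by this sign makes the colouring consistent along e
    switch : Sign
    switch = colour u * (sign G e * colour v)

    root′ : V → V
    root′ w with root w ≟ root v
    ... | yes _ = root u
    ... | no _  = root w

    colour′ : V → Sign
    colour′ w with root w ≟ root v
    ... | yes _ = switch * colour w
    ... | no _  = colour w

    root′-root : ∀ w → root w ≢ root v → root′ (root w) ≡ root w
    root′-root w w≁v with root (root w) ≟ root v
    ... | yes rw~v = ⊥-elim (w≁v (trans (sym (root-idem w)) rw~v))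
    ... | no _     = root-idem w

    colour′-root : ∀ w → root w ≢ root v → colour′ (root w) ≡ +
    colour′-root w w≁v with root (root w) ≟ root v
    ... | yes rw~v = ⊥-elim (w≁v (trans (sym (root-idem w)) rw~v))
    ... | no _     = root-colour w

    root′-idem : ∀ w → root′ (root′ w) ≡ root′ w
    root′-idem w with root w ≟ root v
    ... | yes _  = root′-root u roots≢
    ... | no w≁v = root′-root w w≁v

    root′-colour : ∀ w → colour′ (root′ w) ≡ +
    root′-colour w with root w ≟ root v
    ... | yes _  = colour′-root u roots≢
    ... | no w≁v = colour′-root w w≁v

    path′ : ∀ w → Walk (root′ w) w
    path′ w with root w ≟ root v
    ... | yes w~v = path u ++ (e , j) ∷ reverse (path v) ++ pathFrom w~v
    ... | no _    = path w

    path′-sign : ∀ w → walkSign (path′ w) ≡ colour′ w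
    path′-sign w with root w ≟ root v
    ... | no _    = path-sign w
    ... | yes w~v = begin
      walkSign (path u ++ (e , j) ∷ reverse (path v) ++ pathFrom w~v)
        ≡⟨ walkSign-++ (path u) _ ⟩
      walkSign (path u) * (sign G e * walkSign (reverse (path v) ++ pathFrom w~v))
        ≡⟨ cong (λ s → walkSign (path u) * (sign G e * s)) (walkSign-++ (reverse (path v)) (pathFrom w~v)) ⟩
      walkSign (path u) * (sign G e * (walkSign (reverse (path v)) * walkSign (pathFrom w~v)))
        ≡⟨ cong₂ (λ s t → s * (sign G e * t)) (path-sign u)
                 (cong₂ _*_ (trans (walkSign-reverse (path v)) (path-sign v)) (pathFrom-sign w~v)) ⟩
      colour u * (sign G e * (colour v * colour w))
        ≡⟨ cong (colour u *_) (sym (*-assoc (sign G e) (colour v) (colour w))) ⟩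
      colour u * ((sign G e * colour v) * colour w)
        ≡⟨ sym (*-assoc (colour u) (sign G e * colour v) (colour w)) ⟩
      switch * colour w ∎
      where open ≡-Reasoning

    forest : Forest
    forest = record { root = root′ ; colour = colour′ ; root-idem = root′-idem
                    ; root-colour = root′-colour ; path = path′ ; path-sign = path′-sign }

    extends : F ⊑ forest
    extends {x} {y} (x~y , σ≡) with root x ≟ root v | root y ≟ root v
    ... | yes _   | yes _   = refl , trans σ≡ (sym (*-switch switch (colour x) (colour y)))
    ... | yes x~v | no y≁v  = ⊥-elim (y≁v (trans (sym x~y) x~v))
    ... | no x≁v  | yes y~v = ⊥-elim (x≁v (trans x~y y~v))
    ... | no _    | no _    = x~y , σ≡

    links : Consistent forest u v (sign G e)
    links with root u ≟ root v | root v ≟ root v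
    ... | yes u~v | _      = ⊥-elim (roots≢ u~v)
    ... | no _    | no v≁v = ⊥-elim (v≁v refl)
    ... | no _    | yes _  = refl , sym (begin
      colour u * ((colour u * (sign G e * colour v)) * colour v)
        ≡⟨ cong (colour u *_) (*-assoc (colour u) (sign G e * colour v) (colour v)) ⟩
      colour u * (colour u * ((sign G e * colour v) * colour v))
        ≡⟨ *-cancelˡ-self (colour u) _ ⟩
      (sign G e * colour v) * colour v
        ≡⟨ *-cancelʳ-self (sign G e) (colour v) ⟩
      sign G e ∎)
      where open ≡-Reasoning

  module _ (balanced : Balanced G) where

    insert : (F : Forest) → ∀ {u v e} → Joins G e u v → Σ Forest λ F′ → F ⊑ F′ × Consistent F′ u v (sign G e)
    insert F {u} {v} {e} j with Forest.root F u ≟ Forest.root F v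
    ... | no roots≢ = forest , extends , links
      where open Link F j roots≢
    ... | yes u~v = F , (λ c → c) , u~v , (begin
      sign G e                         ≡⟨ sym (*-cancelʳ-self (sign G e) (colour v)) ⟩
      (sign G e * colour v) * colour v ≡⟨ cong (_* colour v) (sym (*≡+⇒≡ {colour u} cycle-positive)) ⟩
      colour u * colour v              ∎)
      where
      open Forest F
      open ≡-Reasoning
      pv = pathFrom (sym u~v)
      cycle-positive : colour u * (sign G e * colour v) ≡ +
      cycle-positive = begin
        colour u * (sign G e * colour v)
          ≡⟨ cong₂ (λ s t → s * (sign G e * t))
                   (sym (path-sign u)) (sym (trans (walkSign-reverse pv) (pathFrom-sign (sym u~v)))) ⟩
        walkSign (path u) * walkSign ((e , j) ∷ reverse pv)
          ≡⟨ sym (walkSign-++ (path u) _) ⟩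
        walkSign (path u ++ (e , j) ∷ reverse pv)
          ≡⟨ balanced⇒closedWalk-positive balanced (path u ++ (e , j) ∷ reverse pv) ⟩
        + ∎

    ConsistentOn : Forest → V × V × Sign → Set
    ConsistentOn F (u , v , σ) = EdgeWith G u v σ → Consistent F u v σ

    insertAll : (∀ u v σ → Dec (EdgeWith G u v σ)) →
      (L : List (V × V × Sign)) → Σ Forest λ F → All (ConsistentOn F) L
    insertAll edgeWith? [] = discreteForest , []
    insertAll edgeWith? ((u , v , σ) ∷ L) with insertAll edgeWith? L | edgeWith? u v σ
    ... | F , consistentL | no ¬edge = F , (λ edge → ⊥-elim (¬edge edge)) ∷ consistentL
    ... | F , consistentL | yes (e , ends≡ , refl) with insert F (inj₁ ends≡)
    ...   | F′ , F⊑F′ , consistent = F′ , (λ _ → consistent) ∷ All.map (λ c edge → F⊑F′ (c edge)) consistentL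

    balanced⇒positiveSwitching : (vs : List V) → (∀ v → v ∈ vs) → (∀ u v σ → Dec (EdgeWith G u v σ)) →
      Σ (V → Sign) (PositiveSwitching G)
    balanced⇒positiveSwitching vs vs-complete edgeWith? =
      Forest.colour F , λ e → proj₂ (All.lookup consistent (triples-complete e) (e , refl , refl))
      where
      signs = + ∷ - ∷ []
      triples = cartesianProduct vs (cartesianProduct vs signs)
      F = proj₁ (insertAll edgeWith? triples)
      consistent = proj₂ (insertAll edgeWith? triples)
      signs-complete : ∀ σ → σ ∈ signs
      signs-complete + = here refl
      signs-complete - = there (here refl)
      triples-complete : ∀ e → (proj₁ (ends G e) , proj₂ (ends G e) , sign G e) ∈ triples
      triples-complete e =
        ∈-cartesianProduct⁺ (vs-complete _) (∈-cartesianProduct⁺ (vs-complete _) (signs-complete (sign G e)))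

leastWitness : ∀ {P : ℕ → Set} → (∀ k → Dec (P k)) →
  ∀ j → P j → ∃ λ d → d ≤ j × P d × (∀ k → k < d → ¬ P k)
leastWitness {P} P? = <-rec Goal search
  where
  Goal : ℕ → Set
  Goal j = P j → ∃ λ d → d ≤ j × P d × (∀ k → k < d → ¬ P k)
  search : ∀ j → (∀ {k} → k < j → Goal k) → Goal j
  search j below Pj with anyUpTo? P? j
  ... | no none-below = j , ≤-refl , Pj , λ k k<j Pk → none-below (k , k<j , Pk)
  ... | yes (k , k<j , Pk) =
    let d , d≤k , Pd , least = below k<j Pk in d , ≤-trans d≤k (<⇒≤ k<j) , Pd , least

module StrictlyIncreasing {l} {w : Fin l → ℕ} (w-incr : ∀ k k′ → k <ᶠ k′ → w k < w k′) where

  monotone : ∀ {k k′} → k ≤ᶠ k′ → w k ≤ w k′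
  monotone {k} {k′} k≤k′ with k ≟ᶠ k′
  ... | yes refl = ≤-refl
  ... | no k≢k′  = <⇒≤ (w-incr k k′ (≤∧≢⇒<ᶠ k≤k′ k≢k′))

  reflects-< : ∀ {k k′} → w k < w k′ → k <ᶠ k′
  reflects-< {k} {k′} wk<wk′ with k′ ≤ᶠ? k
  ... | yes k′≤k = ⊥-elim (<⇒≱ wk<wk′ (monotone k′≤k))
  ... | no k′≰k  = ≰⇒> k′≰k

  below-predecessor : ∀ {k j k′} → toℕ k′ ≡ suc (toℕ j) → w k < w k′ → w k ≤ w j
  below-predecessor {k} k′≡1+j wk<wk′ = monotone (≤-pred (subst (toℕ k <_) k′≡1+j (reflects-< wk<wk′)))

module Distances {n e : ℕ} (S : SignedGraph (Fin n) (Fin e)) where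

  posAdj? : ∀ u v → Dec (PosAdj S u v)
  posAdj? u v = any? λ f → (sign S f ≟ˢ +) ×-dec ((ends S f ≟ₚ (u , v)) ⊎-dec (ends S f ≟ₚ (v , u)))
    where _≟ₚ_ = ≡-dec _≟ᶠ_ _≟ᶠ_

  inNeg? : ∀ v → Dec (InNeg S v)
  inNeg? v = any? λ f → (sign S f ≟ˢ -) ×-dec ((v ≟ᶠ proj₁ (ends S f)) ⊎-dec (v ≟ᶠ proj₂ (ends S f)))

  posWalk? : ∀ k x y → Dec (PosWalk S x y k)
  posWalk? zero x y with x ≟ᶠ y
  ... | yes refl = yes here
  ... | no x≢y = no λ { here → x≢y refl }
  posWalk? (suc k) x y = map′ (λ (z , xz , zy) → step xz zy) (λ { (step xz zy) → _ , xz , zy })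
                              (any? λ z → posAdj? x z ×-dec posWalk? k z y)

  walkBetween? : ∀ {X Y : Fin n → Set} → Decidable X → Decidable Y → ∀ k → Dec (WalkBetween S X Y k)
  walkBetween? X? Y? k = any? λ x → any? λ y → X? x ×-dec Y? y ×-dec posWalk? k x y

  posAdj-sym : ∀ {u v} → PosAdj S u v → PosAdj S v u
  posAdj-sym (f , positive , j) = f , positive , joins-sym {G = S} j

  posWalk-snoc : ∀ {x y z k} → PosWalk S x y k → PosAdj S y z → PosWalk S x z (suc k)
  posWalk-snoc here yz = step yz here
  posWalk-snoc (step xw wy) yz = step xw (posWalk-snoc wy yz)

  posWalk-reverse : ∀ {x y k} → PosWalk S x y k → PosWalk S y x k
  posWalk-reverse here = here
  posWalk-reverse (step xz zy) = posWalk-snoc (posWalk-reverse zy) (posAdj-sym xz)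

  walkBetween-sym : ∀ {X Y k} → WalkBetween S X Y k → WalkBetween S Y X k
  walkBetween-sym (x , y , x∈X , y∈Y , walk) = y , x , y∈Y , x∈X , posWalk-reverse walk

  walkBetween⇒dist⁺ : ∀ {X Y : Fin n → Set} → Decidable X → Decidable Y →
    ∀ {j} → WalkBetween S X Y j → ∃ λ d → d ≤ j × IsDist⁺ S X Y (fin d)
  walkBetween⇒dist⁺ X? Y? = leastWitness (walkBetween? X? Y?) _

  walkBetweenClasses : ∀ f {x y k} → f x ≢ f y → InNeg S x → InNeg S y → PosWalk S x y k →
    WalkBetween S (ClassOf S f zero) (ClassOf S f (suc zero)) k
  walkBetweenClasses f {x} {y} fx≢fy x∈Σ⁻ y∈Σ⁻ walk with f x in fx | f y in fy
  ... | zero     | zero     = ⊥-elim (fx≢fy refl)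
  ... | zero     | suc zero = x , y , (x∈Σ⁻ , fx) , (y∈Σ⁻ , fy) , walk
  ... | suc zero | zero     = walkBetween-sym (x , y , (x∈Σ⁻ , fx) , (y∈Σ⁻ , fy) , walk)
  ... | suc zero | suc zero = ⊥-elim (fx≢fy refl)

  dist⁺? : ∀ {X Y : Fin n → Set} → Decidable X → Decidable Y → ∀ d → Dec (IsDist⁺ S X Y (fin d))
  dist⁺? X? Y? d = walkBetween? X? Y? d ×-dec
    map′ (λ none j j<d → none j<d) (λ none {j} j<d → none j j<d) (allUpTo? (¬? ∘ walkBetween? X? Y?) d)

-- Two-colourings are read in the sign group, where "different colours" becomes "product is -".
toSign : Fin 2 → Sign
toSign zero = +
toSign (suc zero) = -

fromSign : Sign → Fin 2
fromSign + = zero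
fromSign - = suc zero

fromSign-injective : ∀ {σ σ′} → fromSign σ ≡ fromSign σ′ → σ ≡ σ′
fromSign-injective {+} {+} _ = refl
fromSign-injective { - } { - } _ = refl

toSign-≢ : ∀ {α β} → α ≢ β → toSign α * toSign β ≡ -
toSign-≢ {zero} {zero} α≢β = ⊥-elim (α≢β refl)
toSign-≢ {zero} {suc zero} _ = refl
toSign-≢ {suc zero} {zero} _ = refl
toSign-≢ {suc zero} {suc zero} α≢β = ⊥-elim (α≢β refl)

module Bipartitions {n e : ℕ} (S : SignedGraph (Fin n) (Fin e)) {m : ℕ} (C : Components S m) where
  open Components C
  open Distances S

  toSign-τ : ∀ α → toSign (τ S α) ≡ - * toSign α
  toSign-τ zero = refl
  toSign-τ (suc zero) = refl

  part? : ∀ a → Decidable (Part a)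
  part? (i , α) v = inNeg? v ×-dec (comp v ≟ᶠ i) ×-dec (side v ≟ᶠ α)

  class? : ∀ f α → Decidable (ClassOf S f α)
  class? f α v = inNeg? v ×-dec (f v ≟ᶠ α)

  stable-negAdj : ∀ f → StableCol S f → ∀ {u v} → NegAdj S u v → f u ≢ f v
  stable-negAdj f stable (g , negative , inj₁ refl) = stable g negative
  stable-negAdj f stable (g , negative , inj₂ refl) = stable g negative ∘ sym

  module PartColouring (f : Fin n → Fin 2) (stable : StableCol S f) where

    -- whether f agrees with side or with its flip at u; constant on each component
    offset : Fin n → Sign
    offset u = toSign (f u) * toSign (side u)

    offset-negConn : ∀ {u v} → NegConn S u v → offset u ≡ offset v
    offset-negConn ε = refl
    offset-negConn {u} (_◅_ {j = w} uw wv) = trans (*≡+⇒≡ flips-cancel) (offset-negConn wv)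
      where
      flips-cancel : offset u * offset w ≡ +
      flips-cancel = trans (interchange (toSign (f u)) (toSign (side u)) (toSign (f w)) (toSign (side w)))
                           (cong₂ _*_ (toSign-≢ {f u} {f w} (stable-negAdj f stable uw))
                                      (toSign-≢ {side u} {side w} (stable-negAdj side side-stable uw)))

    partColour : Fin m × Fin 2 → Sign
    partColour (i , α) = toSign α * offset (proj₁ (comp-onto i))

    partColour-spec : ∀ {a u} → Part a u → toSign (f u) ≡ partColour a
    partColour-spec {u = u} (u∈Σ⁻ , refl , refl) = begin
      toSign (f u)                                 ≡⟨ sym (*-cancelʳ-self (toSign (f u)) (toSign (side u))) ⟩
      offset u * toSign (side u)                   ≡⟨ *-comm (offset u) (toSign (side u)) ⟩
      toSign (side u) * offset u                   ≡⟨ cong (toSign (side u) *_) (sym (offset-negConn representative~u)) ⟩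
      toSign (side u) * offset representative      ∎
      where
      open ≡-Reasoning
      representative = proj₁ (comp-onto (comp u))
      representative~u : NegConn S representative u
      representative~u = proj₁ (comp-conn representative u (proj₁ (proj₂ (comp-onto (comp u)))) u∈Σ⁻)
                                (proj₂ (proj₂ (comp-onto (comp u))))

    partColour-τ : ∀ i α → partColour (i , τ S α) ≡ - * partColour (i , α)
    partColour-τ i α = trans (cong (_* _) (toSign-τ α)) (*-assoc - (toSign α) _)

  farApart⇒balanced : ∀ {f} W → StableCol S f →
    (∀ j → j ≤ W → ¬ WalkBetween S (ClassOf S f zero) (ClassOf S f (suc zero)) j) → Balanced (Φ S C W)
  farApart⇒balanced {f} W stable far = positiveSwitching⇒balanced {h = partColour} switching
    where
    open PartColouring f stable

    close⇒sameColour : ∀ {a b} → E′ S C W a b → partColour a ≡ partColour b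
    close⇒sameColour {a} {b} (_ , d , ((x , y , x∈a , y∈b , walk) , _) , d≤W) with f x ≟ᶠ f y
    ... | yes fx≡fy = trans (sym (partColour-spec x∈a)) (trans (cong toSign fx≡fy) (partColour-spec y∈b))
    ... | no fx≢fy  = ⊥-elim (far d d≤W (walkBetweenClasses f fx≢fy (proj₁ x∈a) (proj₁ y∈b) walk))

    switching : PositiveSwitching (Φ S C W) partColour
    switching (inj₁ i) = sym (s*opposite[s]≡- (partColour (i , zero)))
    switching (inj₂ (a , b , inj₁ ab)) = trans (sym (s*s≡+ (partColour a))) (cong (partColour a *_) (close⇒sameColour ab))
    switching (inj₂ (_ , _ , inj₂ ((i , α) , (j , β) , refl , refl , ab))) = begin
      +                                                   ≡⟨ switching (inj₂ (_ , _ , inj₁ ab)) ⟩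
      partColour (i , α) * partColour (j , β)             ≡⟨ sym (*-switch - (partColour (i , α)) (partColour (j , β))) ⟩
      (- * partColour (i , α)) * (- * partColour (j , β)) ≡⟨ sym (cong₂ _*_ (partColour-τ i α) (partColour-τ j β)) ⟩
      partColour (i , τ S α) * partColour (j , τ S β)     ∎
      where open ≡-Reasoning

  unbalanced⇒dist⁺-bounded : ∀ {W f} → ¬ Balanced (Φ S C W) → StableCol S f →
    ∀ d → IsDist⁺ S (ClassOf S f zero) (ClassOf S f (suc zero)) d → d ≤∞ fin W
  unbalanced⇒dist⁺-bounded {W} unbalanced stable ∞ no-walk =
    unbalanced (farApart⇒balanced W stable λ j _ → no-walk j)
  unbalanced⇒dist⁺-bounded {W} unbalanced stable (fin k) (_ , none-shorter) with k ≤? W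
  ... | yes k≤W = k≤W
  ... | no k≰W  =
    ⊥-elim (unbalanced (farApart⇒balanced W stable λ j j≤W → none-shorter j (≤-<-trans j≤W (≰⇒> k≰W))))

  _≟ᵥ_ : DecidableEquality (Fin m × Fin 2)
  _≟ᵥ_ = ≡-dec _≟ᶠ_ _≟ᶠ_

  E′? : ∀ W a b → Dec (E′ S C W a b)
  E′? W a b = ¬? (a ≟ᵥ b) ×-dec
    map′ (λ (d , d<1+W , dist) → d , dist , ≤-pred d<1+W) (λ (d , dist , d≤W) → d , s≤s d≤W , dist)
         (anyUpTo? (dist⁺? (part? a) (part? b)) (suc W))

  flip : Fin m × Fin 2 → Fin m × Fin 2
  flip (i , α) = i , τ S α

  flip-involutive : ∀ a → flip (flip a) ≡ a
  flip-involutive (i , zero) = refl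
  flip-involutive (i , suc zero) = refl

  E″? : ∀ W a b → Dec (E″ S C W a b)
  E″? W a b = map′ (λ e′ → flip a , flip b , sym (flip-involutive a) , sym (flip-involutive b) , e′)
                   (λ { (a′ , b′ , refl , refl , e′) →
                          subst₂ (E′ S C W) (sym (flip-involutive a′)) (sym (flip-involutive b′)) e′ })
                   (E′? W (flip a) (flip b))

  Φ-edgeWith? : ∀ W u v σ → Dec (EdgeWith (Φ S C W) u v σ)
  Φ-edgeWith? W u v + = map′ (λ uv → inj₂ (u , v , uv) , refl , refl)
                             (λ { (inj₂ (_ , _ , uv) , refl , refl) → uv })
                             (E′? W u v ⊎-dec E″? W u v)
  Φ-edgeWith? W (i , α) (j , β) - =
    map′ (λ { (refl , refl , refl) → inj₁ i , refl , refl })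
         (λ { (inj₁ _ , refl , _) → refl , refl , refl })
         ((i ≟ᶠ j) ×-dec (α ≟ᶠ zero) ×-dec (β ≟ᶠ suc zero))

  Φ-balanced⇒positiveSwitching : ∀ W → Balanced (Φ S C W) → Σ (Fin m × Fin 2 → Sign) (PositiveSwitching (Φ S C W))
  Φ-balanced⇒positiveSwitching W balanced =
    Harary.balanced⇒positiveSwitching (Φ S C W) _≟ᵥ_ balanced (cartesianProduct (allFin m) (allFin 2))
      (λ (i , α) → ∈-cartesianProduct⁺ (∈-allFin i) (∈-allFin α)) (Φ-edgeWith? W)

  colouringOf : (Fin m × Fin 2 → Sign) → Fin n → Fin 2
  colouringOf h v = fromSign (h (comp v , side v))

  record Separating (W : ℕ) (h : Fin m × Fin 2 → Sign) : Set where
    field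
      sides-opposite    : ∀ i → h (i , zero) * h (i , suc zero) ≡ -
      close-parts-agree : ∀ {a b d} → a ≢ b → IsDist⁺ S (Part a) (Part b) (fin d) → d < W → h a ≡ h b

  module _ {W h} (separating : Separating W h) where
    open Separating separating

    private
      f = colouringOf h

    sides-differ : ∀ {i α β} → α ≢ β → h (i , α) ≢ h (i , β)
    sides-differ {i} {zero} {suc zero} _ h≡ =
      case trans (sym (sides-opposite i)) (trans (cong (_* h (i , suc zero)) h≡) (s*s≡+ (h (i , suc zero)))) of λ ()
    sides-differ {i} {suc zero} {zero} _ h≡ =
      case trans (sym (sides-opposite i)) (trans (cong (h (i , zero) *_) h≡) (s*s≡+ (h (i , zero)))) of λ ()
    sides-differ {α = zero} {zero} α≢β = ⊥-elim (α≢β refl)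
    sides-differ {α = suc zero} {suc zero} α≢β = ⊥-elim (α≢β refl)

    separating⇒stable : StableCol S f
    separating⇒stable g negative fx≡fy =
      sides-differ (side-stable g negative)
                   (trans (fromSign-injective fx≡fy) (cong (λ i → h (i , side y)) (sym same-component)))
      where
      x = proj₁ (ends S g)
      y = proj₂ (ends S g)
      same-component : comp x ≡ comp y
      x~y : NegAdj S x y
      x~y = g , negative , inj₁ refl
      same-component = proj₂ (comp-conn x y (g , negative , inj₁ refl) (g , negative , inj₂ refl)) (x~y ◅ ε)

    separating⇒noShortWalk : ∀ j → j < W → ¬ WalkBetween S (ClassOf S f zero) (ClassOf S f (suc zero)) j
    separating⇒noShortWalk j j<W (x , y , (x∈Σ⁻ , fx) , (y∈Σ⁻ , fy) , walk) =
      different-classes (cong fromSign same-colour)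
      where
      a = (comp x , side x)
      b = (comp y , side y)
      different-classes : f x ≢ f y
      different-classes fx≡fy = case trans (sym fx) (trans fx≡fy fy) of λ ()
      closest : ∃ λ d → d ≤ j × IsDist⁺ S (Part a) (Part b) (fin d)
      closest = walkBetween⇒dist⁺ (part? a) (part? b) (x , y , (x∈Σ⁻ , refl , refl) , (y∈Σ⁻ , refl , refl) , walk)
      same-colour : h a ≡ h b
      same-colour = close-parts-agree (different-classes ∘ cong (fromSign ∘ h)) (proj₂ (proj₂ closest))
                                      (≤-<-trans (proj₁ (proj₂ closest)) j<W)

    separating⇒dist⁺ : ¬ Balanced (Φ S C W) → IsDist⁺ S (ClassOf S f zero) (ClassOf S f (suc zero)) (fin W)
    separating⇒dist⁺ unbalanced with walkBetween? (class? f zero) (class? f (suc zero)) W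
    ... | yes walk = walk , separating⇒noShortWalk
    ... | no ¬walk = ⊥-elim (unbalanced (farApart⇒balanced W separating⇒stable far))
      where
      far : ∀ j → j ≤ W → ¬ WalkBetween S (ClassOf S f zero) (ClassOf S f (suc zero)) j
      far j j≤W with j ≟ℕ W
      ... | yes refl = ¬walk
      ... | no j≢W   = separating⇒noShortWalk j (≤∧≢⇒< j≤W j≢W)

  sides⇒separating : ∀ {W} → (∀ d → InW S C d → W ≤ d) → Separating W (toSign ∘ proj₂)
  sides⇒separating below = record
    { sides-opposite = λ _ → refl
    ; close-parts-agree = λ {a} {b} a≢b dist d<W → ⊥-elim (<⇒≱ d<W (below _ (a , b , a≢b , dist))) }

  positiveSwitching⇒separating : ∀ {W W′ h} → PositiveSwitching (Φ S C W) h →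
    (∀ d → InW S C d → d < W′ → d ≤ W) → Separating W′ h
  positiveSwitching⇒separating switching below = record
    { sides-opposite = λ i → sym (switching (inj₁ i))
    ; close-parts-agree = λ {a} {b} {d} a≢b dist d<W′ →
        *≡+⇒≡ (sym (switching (inj₂ (a , b , inj₁ (a≢b , d , dist , below d (a , b , a≢b , dist) d<W′))))) }

theorem5p3 : {n e : ℕ} (S : SignedGraph (Fin n) (Fin e)) {m : ℕ} (C : Components S m)
    (l : ℕ) (w : Fin l → ℕ)
    (w-incr : ∀ k k′ → k <ᶠ k′ → w k < w k′)
    (w-in : ∀ k → InW S C (w k))
    (w-onto : ∀ d → InW S C d → ∃ λ k → w k ≡ d)
    (p : Fin l)
    (p-unbal : ¬ Balanced (Φ S C (w p)))
    (p-min : ∀ k → k <ᶠ p → Balanced (Φ S C (w k))) →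
    (∃ λ f → StableCol S f × IsDist⁺ S (ClassOf S f zero) (ClassOf S f (suc zero)) (fin (w p)))
    × (∀ f → StableCol S f → ∀ d → IsDist⁺ S (ClassOf S f zero) (ClassOf S f (suc zero)) d → d ≤∞ fin (w p))
theorem5p3 S {m} C _ w w-incr _ w-onto p p-unbal p-min =
  (colouringOf h , separating⇒stable separating , separating⇒dist⁺ separating p-unbal) ,
  λ f stable → unbalanced⇒dist⁺-bounded p-unbal stable
  where
  open Bipartitions S C
  open StrictlyIncreasing w-incr

  separatingAt : ∀ r → (∀ k → k <ᶠ r → Balanced (Φ S C (w k))) → Σ (Fin m × Fin 2 → Sign) (Separating (w r))
  separatingAt zero _ = toSign ∘ proj₂ , sides⇒separating λ d d∈W →
    case w-onto d d∈W of λ { (k , refl) → monotone z≤n }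
  separatingAt (suc q) earlier-balanced =
    let h , switching = Φ-balanced⇒positiveSwitching (w (inject₁ q))
                          (earlier-balanced (inject₁ q) (≤̄⇒inject₁< ≤ᶠ-refl))
    in h , positiveSwitching⇒separating switching λ d d∈W d<w →
         case w-onto d d∈W of λ { (k , refl) → below-predecessor (cong suc (sym (toℕ-inject₁ q))) d<w }

  h = proj₁ (separatingAt p p-min)
  separating = proj₂ (separatingAt p p-min)
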